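{- Let $(W,S)$ be a Coxeter system and $C$ a parabolic double coset. (a) There exists $w\in W$ with $C=W_{M_L(C)}wW_{M_R(C)}$, and this is the largest possible presentation of $C$ in the sense that if $C=W_Iw'W_J$ for some $I,J\subseteq S$, $w'\in W$, then $I\subseteq M_L(C)$ and $J\subseteq M_R(C)$. (b) $M_L(C)=\{s\in S: sx\in C\text{ for all }x\in C\}$ and $M_R(C)=\{s\in S: xs\in C\text{ for all }x\in C\}$.
   Context: $(W,S)$ is a Coxeter system with $S$ finite; $W_I$ is the subgroup generated by $I\subseteq S$. A parabolic double coset is a subset $C=W_IxW_J$ with $I,J\subseteq S$, $x\in W$; a presentation of $C$ is a triple $(I,x,J)$ with $C=W_IxW_J$. Define $M_L(C)=\bigcup I$ and $M_R(C)=\bigcup J$, the unions over all presentations $(I,x,J)$ of $C$. -}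

module Defs where

open import Level using (0ℓ)
open import Data.Nat using (ℕ; zero; suc)
open import Data.Fin using (Fin)
open import Data.List using (List; []; _∷_; _++_)
open import Data.List.Relation.Unary.All using (All)
open import Data.Product using (Σ; ∃; _×_; _,_)
open import Relation.Nullary using (¬_)
open import Relation.Binary.PropositionalEquality using (_≡_)
open import Relation.Unary using (Pred; _⊆_)
open import Data.Fin.Subset using (Subset; _∈_)

-- A Coxeter matrix on the finite generating set S = Fin n.
-- Entry 0 encodes m(s,t) = ∞ (no relation).
record CoxeterMatrix (n : ℕ) : Set where
  field
    m     : Fin n → Fin n → ℕ
    diag  : ∀ i → m i i ≡ 1
    symm  : ∀ i j → m i j ≡ m j i
    off   : ∀ i j → ¬ (i ≡ j) → ¬ (m i j ≡ 1)

module Coxeter {n : ℕ} (M : CoxeterMatrix n) where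
  open CoxeterMatrix M

  Word : Set
  Word = List (Fin n)

  alt : Fin n → Fin n → ℕ → Word
  alt s t zero    = []
  alt s t (suc k) = s ∷ t ∷ alt s t k

  -- Equality in W = ⟨ S | (s t)^{m(s,t)} = e ⟩ : the congruence on words
  -- generated by the Coxeter relations.
  infix 4 _≈_
  data _≈_ : Word → Word → Set where
    ≈-refl  : ∀ {u} → u ≈ u
    ≈-sym   : ∀ {u v} → u ≈ v → v ≈ u
    ≈-trans : ∀ {u v w} → u ≈ v → v ≈ w → u ≈ w
    ≈-cong  : ∀ {u u′ v v′} → u ≈ u′ → v ≈ v′ → u ++ v ≈ u′ ++ v′
    ≈-rel   : ∀ s t → alt s t (m s t) ≈ []

  SubS : Set₁
  SubS = Pred (Fin n) 0ℓ

  SubW : Set₁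
  SubW = Pred Word 0ℓ

  _≐_ : SubW → SubW → Set
  A ≐ B = (A ⊆ B) × (B ⊆ A)

  _≐S_ : SubS → SubS → Set
  A ≐S B = (A ⊆ B) × (B ⊆ A)

  Parabolic : SubS → SubW
  Parabolic I w = Σ Word λ u → All I u × (w ≈ u)

  DC : SubS → Word → SubS → SubW
  DC I x J w = Σ Word λ u → Σ Word λ v →
    Parabolic I u × Parabolic J v × (w ≈ u ++ x ++ v)

  ⟦_⟧ : Subset n → SubS
  ⟦ I ⟧ s = s ∈ I

  Presentation : SubW → Subset n → Word → Subset n → Set
  Presentation C I x J = C ≐ DC ⟦ I ⟧ x ⟦ J ⟧

  IsParabolicDC : SubW → Set
  IsParabolicDC C = Σ (Subset n) λ I → Σ Word λ x → Σ (Subset n) λ J → Presentation C I x J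

  ML : SubW → SubS
  ML C s = Σ (Subset n) λ I → Σ Word λ x → Σ (Subset n) λ J → Presentation C I x J × (s ∈ I)

  MR : SubW → SubS
  MR C s = Σ (Subset n) λ I → Σ Word λ x → Σ (Subset n) λ J → Presentation C I x J × (s ∈ J)

-- Left multiplication by s ∈ I preserves W_I x W_J, and the property "sC ⊆ C" is
-- intrinsic to C.  Conversely, if sC ⊆ C then (I ∪ {s}, x, J) is again a presentation
-- of C, since W_{I ∪ {s}} x W_J is generated from x by steps that C is closed under.
-- Hence M_L(C) is exactly the left stabiliser {s : sC ⊆ C} (dually on the right), and
-- widening any presentation (I, x, J) to (M_L(C), x, M_R(C)) still presents C.
module Submission where

open import Defs
open import Data.Nat using (ℕ)
open import Data.List using ([]; _∷_; _++_)
open import Data.List.Properties using (++-assoc; ++-identityʳ)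
open import Data.List.Relation.Unary.All using (All; []; _∷_) renaming (map to All-map)
open import Data.List.Relation.Unary.All.Properties using (++⁺)
open import Data.Product using (Σ; _×_; _,_; proj₁; proj₂)
open import Data.Sum using (inj₁; inj₂)
open import Data.Fin.Subset using (Subset; _∪_; ⁅_⁆)
open import Data.Fin.Subset.Properties using (p⊆p∪q; q⊆p∪q; x∈p∪q⁻; x∈⁅x⁆; x∈⁅y⁆⇒x≡y)
open import Relation.Binary.Definitions using (_Respects_)
open import Relation.Binary.PropositionalEquality using (_≡_; refl; sym; cong; subst; module ≡-Reasoning)
open import Relation.Unary using (_⊆_)

module _ {n : ℕ} (M : CoxeterMatrix n) where
  open Coxeter M

  LeftStabiliser : SubW → SubS
  LeftStabiliser C s = ∀ x → C x → C (s ∷ x)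

  RightStabiliser : SubW → SubS
  RightStabiliser C s = ∀ x → C x → C (x ++ s ∷ [])

  ≡⇒≈ : ∀ {u v} → u ≡ v → u ≈ v
  ≡⇒≈ refl = ≈-refl

  DC-respects-≈ : ∀ {I x J} → DC I x J Respects _≈_
  DC-respects-≈ w≈w′ (u , v , u∈ , v∈ , w≈uxv) = u , v , u∈ , v∈ , ≈-trans (≈-sym w≈w′) w≈uxv

  DC-mono : ∀ {I I′ x J J′} → I ⊆ I′ → J ⊆ J′ → DC I x J ⊆ DC I′ x J′
  DC-mono I⊆I′ J⊆J′ (u , v , (u′ , Iu′ , u≈u′) , (v′ , Jv′ , v≈v′) , w≈uxv) =
    u , v , (u′ , All-map I⊆I′ Iu′ , u≈u′) , (v′ , All-map J⊆J′ Jv′ , v≈v′) , w≈uxv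

  DC-∋ : ∀ {I x J} → DC I x J x
  DC-∋ {x = x} = [] , [] , ([] , [] , ≈-refl) , ([] , [] , ≈-refl) , ≡⇒≈ (sym (++-identityʳ x))

  DC-left-stable : ∀ {I x J} → I ⊆ LeftStabiliser (DC I x J)
  DC-left-stable {_} {_} {_} {s} s∈I w (u , v , (u′ , Iu′ , u≈u′) , v∈ , w≈uxv) =
    s ∷ u , v , (s ∷ u′ , s∈I ∷ Iu′ , ≈-cong (≈-refl {s ∷ []}) u≈u′) , v∈ ,
    ≈-cong (≈-refl {s ∷ []}) w≈uxv

  DC-right-stable : ∀ {I x J} → J ⊆ RightStabiliser (DC I x J)
  DC-right-stable {_} {x} {_} {s} s∈J w (u , v , u∈ , (v′ , Jv′ , v≈v′) , w≈uxv) =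
    u , v ++ s ∷ [] , u∈ , (v′ ++ s ∷ [] , ++⁺ Jv′ (s∈J ∷ []) , ≈-cong v≈v′ ≈-refl) ,
    ≈-trans (≈-cong w≈uxv ≈-refl) (≡⇒≈ reassociate)
    where
    open ≡-Reasoning
    reassociate : (u ++ x ++ v) ++ s ∷ [] ≡ u ++ x ++ v ++ s ∷ []
    reassociate = begin
      (u ++ x ++ v) ++ s ∷ []  ≡⟨ ++-assoc u (x ++ v) _ ⟩
      u ++ (x ++ v) ++ s ∷ []  ≡⟨ cong (u ++_) (++-assoc x v _) ⟩
      u ++ x ++ v ++ s ∷ []    ∎

  word-left-stable : ∀ {C : SubW} {L : SubS} {u y} → L ⊆ LeftStabiliser C → All L u → C y → C (u ++ y)
  word-left-stable L⊆ []           y∈C = y∈C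
  word-left-stable L⊆ (s∈L ∷ Lu) y∈C = L⊆ s∈L _ (word-left-stable L⊆ Lu y∈C)

  word-right-stable : ∀ {C : SubW} {R : SubS} {v y} → R ⊆ RightStabiliser C → All R v → C y → C (y ++ v)
  word-right-stable {C} {y = y} R⊆ [] y∈C = subst C (sym (++-identityʳ y)) y∈C
  word-right-stable {C} {v = s ∷ v} {y} R⊆ (s∈R ∷ Rv) y∈C =
    subst C (++-assoc y (s ∷ []) v) (word-right-stable R⊆ Rv (R⊆ s∈R y y∈C))

  DC-least : ∀ {C : SubW} {L : SubS} {x} {R : SubS} → C Respects _≈_ → C x →
             L ⊆ LeftStabiliser C → R ⊆ RightStabiliser C → DC L x R ⊆ C
  DC-least {x = x} resp x∈C L⊆ R⊆ (u , v , (u′ , Lu′ , u≈u′) , (v′ , Rv′ , v≈v′) , w≈uxv) =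
    resp (≈-sym (≈-trans w≈uxv (≈-cong u≈u′ (≈-cong (≈-refl {x}) v≈v′))))
         (word-left-stable L⊆ Lu′ (word-right-stable R⊆ Rv′ x∈C))

  module _ {C : SubW} {I : Subset n} {x : Word} {J : Subset n} (p : Presentation C I x J) where

    presentation-respects-≈ : C Respects _≈_
    presentation-respects-≈ w≈w′ w∈C = proj₂ p (DC-respects-≈ w≈w′ (proj₁ p w∈C))

    presentation-left-stable : ⟦ I ⟧ ⊆ LeftStabiliser C
    presentation-left-stable s∈I w w∈C = proj₂ p (DC-left-stable s∈I w (proj₁ p w∈C))

    presentation-right-stable : ⟦ J ⟧ ⊆ RightStabiliser C
    presentation-right-stable s∈J w w∈C = proj₂ p (DC-right-stable s∈J w (proj₁ p w∈C))

    presentation-widen : ∀ {I′ J′ : SubS} → ⟦ I ⟧ ⊆ I′ → ⟦ J ⟧ ⊆ J′ →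
                         I′ ⊆ LeftStabiliser C → J′ ⊆ RightStabiliser C → C ≐ DC I′ x J′
    presentation-widen I⊆I′ J⊆J′ I′⊆ J′⊆ =
      (λ w∈C → DC-mono I⊆I′ J⊆J′ (proj₁ p w∈C)) ,
      DC-least presentation-respects-≈ (proj₂ p DC-∋) I′⊆ J′⊆

  ∪-singleton-⊆ : ∀ {P : SubS} (I : Subset n) {s} → ⟦ I ⟧ ⊆ P → P s → ⟦ I ∪ ⁅ s ⁆ ⟧ ⊆ P
  ∪-singleton-⊆ I {s} I⊆P Ps t∈ with x∈p∪q⁻ I ⁅ s ⁆ t∈
  ... | inj₁ t∈I = I⊆P t∈I
  ... | inj₂ t∈s with x∈⁅y⁆⇒x≡y s t∈s
  ... | refl = Ps

  module _ {C : SubW} where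

    presentation⊆ML : ∀ {I x J} → Presentation C I x J → ⟦ I ⟧ ⊆ ML C
    presentation⊆ML {I} {x} {J} p s∈I = I , x , J , p , s∈I

    presentation⊆MR : ∀ {I x J} → Presentation C I x J → ⟦ J ⟧ ⊆ MR C
    presentation⊆MR {I} {x} {J} p s∈J = I , x , J , p , s∈J

    ML⊆LeftStabiliser : ML C ⊆ LeftStabiliser C
    ML⊆LeftStabiliser (_ , _ , _ , p , s∈I) = presentation-left-stable p s∈I

    MR⊆RightStabiliser : MR C ⊆ RightStabiliser C
    MR⊆RightStabiliser (_ , _ , _ , p , s∈J) = presentation-right-stable p s∈J

    LeftStabiliser⊆ML : IsParabolicDC C → LeftStabiliser C ⊆ ML C
    LeftStabiliser⊆ML (I , x , J , p) {s} sC⊆C =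
      I ∪ ⁅ s ⁆ , x , J ,
      presentation-widen p (p⊆p∪q ⁅ s ⁆) (λ s∈J → s∈J)
        (∪-singleton-⊆ I (presentation-left-stable p) sC⊆C) (presentation-right-stable p) ,
      q⊆p∪q I ⁅ s ⁆ (x∈⁅x⁆ s)

    RightStabiliser⊆MR : IsParabolicDC C → RightStabiliser C ⊆ MR C
    RightStabiliser⊆MR (I , x , J , p) {s} Cs⊆C =
      I , x , J ∪ ⁅ s ⁆ ,
      presentation-widen p (λ s∈I → s∈I) (p⊆p∪q ⁅ s ⁆)
        (presentation-left-stable p) (∪-singleton-⊆ J (presentation-right-stable p) Cs⊆C) ,
      q⊆p∪q J ⁅ s ⁆ (x∈⁅x⁆ s)

proposition4p3 : {n : ℕ} (M : CoxeterMatrix n) →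
    let open Coxeter M in
    (C : SubW) → IsParabolicDC C →
    ((Σ Word λ w → C ≐ DC (ML C) w (MR C))
    × (∀ (I : Subset n) (w′ : Word) (J : Subset n) → Presentation C I w′ J →
    (⟦ I ⟧ ⊆ ML C) × (⟦ J ⟧ ⊆ MR C)))
    × ((ML C ≐S (λ s → ∀ x → C x → C (s ∷ x)))
    × (MR C ≐S (λ s → ∀ x → C x → C (x ++ s ∷ []))))
proposition4p3 M C C-parabolic@(I , x , J , p) =
  ( ( x , presentation-widen M p (presentation⊆ML M p) (presentation⊆MR M p)
                                 (ML⊆LeftStabiliser M) (MR⊆RightStabiliser M) )
  , (λ _ _ _ q → presentation⊆ML M q , presentation⊆MR M q) )
  , (ML⊆LeftStabiliser M , LeftStabiliser⊆ML M C-parabolic)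
  , (MR⊆RightStabiliser M , RightStabiliser⊆MR M C-parabolic)
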